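{- We have $T_1(N,0)=0$ for $N\ge1$, and for integers $N\ge k\ge1$, $$T_1(N,k)=(\theta^{N-1}+\cdots+\theta^{N-k})\,(P_{N-1})!.$$
   Context: Let $\theta>0$. $\mathrm{inv}(\pi)$ is the number of pairs $i<j$ with $\pi_i>\pi_j$. $P_n=1+\theta+\cdots+\theta^{n-1}$, $(P_n)!=P_n\cdots P_1$, $(P_0)!=1$. For $\pi\in S_n$, position $i$ is a left-to-right maximum if $\pi_i>\pi_j$ for all $j<i$. $\pi$ is $k$-pickable if some position $i>k$ is a left-to-right maximum (i.e. the strategy rejecting the first $k$ candidates and then accepting the next left-to-right maximum makes a selection). $T_1(n,k)=\sum_{\pi\in S_n\text{ not }k\text{ -pickable}}\theta^{\mathrm{inv}(\pi)}$. -}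

module Defs where

open import Level using (Level)
open import Data.Nat as ℕ using (ℕ; zero; suc; _∸_)
open import Data.Fin as Fin using (Fin; toℕ)
open import Data.Fin.Properties using (all?; any?; _≟_)
open import Data.Vec using (Vec; []; _∷_; lookup)
open import Data.List using (List; []; _∷_; [_]; map; concatMap; filter; foldr)
open import Data.List as List using ()
open import Data.Nat.ListAction using () renaming (sum to sumℕ)
open import Data.Product using (∃; _×_; _,_)
open import Relation.Nullary using (Dec; ¬_; ¬?; does)
open import Data.Bool using (if_then_else_)
open import Relation.Nullary.Decidable using (_→-dec_; _×-dec_)
open import Relation.Binary.PropositionalEquality using (_≡_)
open import Algebra.Bundles using (CommutativeSemiring)

-- A permutation π ∈ S_n is represented by its one-line notation
-- (π_1, …, π_n) as a vector of length n with entries in Fin n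
-- (positions and values 0-indexed), subject to being injective.

allVecs : (k m : ℕ) → List (Vec (Fin m) k)
allVecs zero    m = [ [] ]
allVecs (suc k) m = concatMap (λ x → map (x ∷_) (allVecs k m)) (List.allFin m)

IsPerm : {n : ℕ} → Vec (Fin n) n → Set
IsPerm {n} π = ∀ (i j : Fin n) → lookup π i ≡ lookup π j → i ≡ j

isPerm? : {n : ℕ} → (π : Vec (Fin n) n) → Dec (IsPerm π)
isPerm? π = all? λ i → all? λ j → (lookup π i ≟ lookup π j) →-dec (i ≟ j)

Sym : (n : ℕ) → List (Vec (Fin n) n)
Sym n = filter isPerm? (allVecs n n)

inv : {n : ℕ} → Vec (Fin n) n → ℕ
inv {n} π = sumℕ (map (λ i → sumℕ (map (λ j → count i j) (List.allFin n))) (List.allFin n))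
  where
  count : Fin n → Fin n → ℕ
  count i j = if does ((i Fin.<? j) ×-dec (lookup π j Fin.<? lookup π i)) then 1 else 0

IsLRMax : {n : ℕ} → Vec (Fin n) n → Fin n → Set
IsLRMax π i = ∀ j → j Fin.< i → lookup π j Fin.< lookup π i

isLRMax? : {n : ℕ} → (π : Vec (Fin n) n) → (i : Fin n) → Dec (IsLRMax π i)
isLRMax? π i = all? λ j → (j Fin.<? i) →-dec (lookup π j Fin.<? lookup π i)

-- π is k-pickable: some 1-indexed position i > k (0-indexed position i' ≥ k)
-- is a left-to-right maximum
Pickable : {n : ℕ} → ℕ → Vec (Fin n) n → Set
Pickable k π = ∃ λ i → (k ℕ.≤ toℕ i) × IsLRMax π i

pickable? : {n : ℕ} → (k : ℕ) → (π : Vec (Fin n) n) → Dec (Pickable k π)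
pickable? k π = any? λ i → (k ℕ.≤? toℕ i) ×-dec isLRMax? π i

module Over {c ℓ : Level} (R : CommutativeSemiring c ℓ) (θ : CommutativeSemiring.Carrier R) where
  open CommutativeSemiring R

  pow : ℕ → Carrier
  pow zero    = 1#
  pow (suc m) = θ * pow m

  P : ℕ → Carrier
  P zero    = 0#
  P (suc m) = P m + pow m

  Pfact : ℕ → Carrier
  Pfact zero    = 1#
  Pfact (suc m) = P (suc m) * Pfact m

  sumR : List Carrier → Carrier
  sumR = foldr _+_ 0#

  T₁ : ℕ → ℕ → Carrier
  T₁ n k = sumR (map (λ π → pow (inv π)) (filter (λ π → ¬? (pickable? k π)) (Sym n)))

  topPowers : ℕ → ℕ → Carrier
  topPowers N zero    = 0#
  topPowers N (suc j) = topPowers N j + pow (N ∸ suc j)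

module Submission where

-- Split a permutation π of {0,…,n} by its first value a: π = a ∷ (punchIn a ∘ w) for a unique
-- w ∈ Sₙ, and the first entry is involved in exactly a inversions, so θ^inv π = θ^a θ^inv w;
-- summing over a gives the Mahonian product Σ_{π ∈ Sₙ} θ^inv π = (Pₙ)!. A permutation is k-pickable iff
-- its maximum sits at a position ≥ k. If a is the maximum, π is not (k+1)-pickable; otherwise
-- the maximum of π sits one place later than that of w, so π is (k+1)-pickable iff w is
-- k-pickable. Hence T₁(n+1,k+1) = Pₙ T₁(n,k) + θⁿ (Pₙ)!, while T₁(n+1,0) = 0 because the first
-- position is always a left-to-right maximum; induction on k gives the closed form.

open import Defs
open import Level using (Level)
open import Function using (_∘_; _⇔_; mk⇔; Equivalence)
open import Data.Nat as ℕ using (ℕ; zero; suc; 2+; _≤_; _∸_; z≤n; s≤s)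
import Data.Nat.Properties as ℕ
open import Data.Fin as Fin using (Fin; toℕ; punchIn; punchOut; fromℕ; inject₁)
import Data.Fin.Properties as Fin
open import Data.Fin.Permutation using (Permutation; permutation)
open import Data.Vec as Vec using (Vec; _∷_; lookup)
import Data.Vec.Properties as Vec
open import Data.Vec.Membership.Propositional using (_∈_)
open import Data.Vec.Relation.Unary.Any using (here; there; index)
open import Data.Vec.Relation.Unary.Any.Properties using (lookup-index)
open import Data.List as List using (List; []; _∷_; _++_; map; filter; concatMap; foldr; allFin; tabulate)
import Data.List.Properties as List
open import Data.List.Relation.Unary.All as All using (All; []; _∷_)
open import Data.List.Relation.Unary.All.Properties using (all-filter)
open import Data.Bool using (if_then_else_; true; false)
open import Data.Product using (_×_; _,_; ∃; proj₁; proj₂)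
open import Relation.Nullary using (Dec; yes; no; does; ¬_; ¬?; contradiction)
open import Relation.Nullary.Decidable using (does-⇔)
open import Relation.Unary using (Pred; Decidable)
open import Relation.Binary.PropositionalEquality as ≡ using (_≡_; _≢_; cong; cong₂)
open import Algebra.Bundles using (CommutativeSemiring)
import Algebra.Properties.CommutativeSemigroup

module Sums {c ℓ : Level} (R : CommutativeSemiring c ℓ) where

  open CommutativeSemiring R
  open import Algebra.Properties.Semiring.Sum semiring public
  open import Relation.Binary.Reasoning.Setoid setoid

  private variable
    a p : Level
    A B : Set a

  listSum : List Carrier → Carrier
  listSum = foldr _+_ 0#

  infix 6 _when_
  _when_ : Carrier → Dec A → Carrier
  x when d = if does d then x else 0#

  when-⇔ : ∀ x (a? : Dec A) (b? : Dec B) → A ⇔ B → x when a? ≡ x when b?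
  when-⇔ x a? b? A⇔B = cong (if_then x else 0#) (does-⇔ A⇔B a? b?)

  when-congˡ : ∀ {x y} (a? : Dec A) → x ≈ y → x when a? ≈ y when a?
  when-congˡ (yes _) x≈y = x≈y
  when-congˡ (no _) _ = refl

  when-yes : ∀ x (a? : Dec A) → A → x when a? ≈ x
  when-yes x (yes _) _ = refl
  when-yes x (no ¬a) a = contradiction a ¬a

  when-no : ∀ x (a? : Dec A) → ¬ A → x when a? ≈ 0#
  when-no x (yes a) ¬a = contradiction a ¬a
  when-no x (no _) _ = refl

  *-distribˡ-when : ∀ y x (a? : Dec A) → y * (x when a?) ≈ (y * x) when a?
  *-distribˡ-when y x (yes _) = refl
  *-distribˡ-when y x (no _) = zeroʳ y

  sum-map-congᴬ : ∀ {f g : A → Carrier} {xs} → All (λ x → f x ≈ g x) xs →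
                  listSum (map f xs) ≈ listSum (map g xs)
  sum-map-congᴬ [] = refl
  sum-map-congᴬ (fx≈gx ∷ eqs) = +-cong fx≈gx (sum-map-congᴬ eqs)

  sum-map-cong : ∀ {f g : A → Carrier} xs → (∀ x → f x ≈ g x) → listSum (map f xs) ≈ listSum (map g xs)
  sum-map-cong xs f≈g = sum-map-congᴬ {xs = xs} (All.tabulate λ {x} _ → f≈g x)

  sum-map-zero : ∀ {f : A → Carrier} xs → (∀ x → f x ≈ 0#) → listSum (map f xs) ≈ 0#
  sum-map-zero [] f≈0 = refl
  sum-map-zero (x ∷ xs) f≈0 = trans (+-cong (f≈0 x) (sum-map-zero xs f≈0)) (+-identityˡ 0#)

  sum-map-++ : ∀ (f : A → Carrier) xs ys → listSum (map f (xs ++ ys)) ≈ listSum (map f xs) + listSum (map f ys)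
  sum-map-++ f [] ys = sym (+-identityˡ _)
  sum-map-++ f (x ∷ xs) ys = trans (+-congˡ (sum-map-++ f xs ys)) (sym (+-assoc _ _ _))

  *-distribˡ-sum-map : ∀ y (f : A → Carrier) xs → y * listSum (map f xs) ≈ listSum (map (λ x → y * f x) xs)
  *-distribˡ-sum-map y f [] = zeroʳ y
  *-distribˡ-sum-map y f (x ∷ xs) = trans (distribˡ y _ _) (+-congˡ (*-distribˡ-sum-map y f xs))

  sum-map-filter : ∀ {P : Pred A p} (P? : Decidable P) (f : A → Carrier) xs →
    listSum (map f (filter P? xs)) ≈ listSum (map (λ x → f x when P? x) xs)
  sum-map-filter P? f [] = refl
  sum-map-filter P? f (x ∷ xs) with does (P? x)
  ... | true = +-congˡ (sum-map-filter P? f xs)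
  ... | false = trans (sum-map-filter P? f xs) (sym (+-identityˡ _))

  sum-map-concatMap : ∀ (f : B → Carrier) (h : A → List B) xs →
    listSum (map f (concatMap h xs)) ≈ listSum (map (λ x → listSum (map f (h x))) xs)
  sum-map-concatMap f h [] = refl
  sum-map-concatMap f h (x ∷ xs) =
    trans (sum-map-++ f (h x) (concatMap h xs)) (+-congˡ (sum-map-concatMap f h xs))

  sum-tabulate : ∀ {n} (f : Fin n → Carrier) → listSum (tabulate f) ≡ ∑[ i < n ] f i
  sum-tabulate {zero} f = ≡.refl
  sum-tabulate {suc n} f = cong (f Fin.zero +_) (sum-tabulate (f ∘ Fin.suc))

  sum-map-allFin : ∀ n (f : Fin n → Carrier) → listSum (map f (allFin n)) ≡ ∑[ i < n ] f i
  sum-map-allFin n f = ≡.trans (cong listSum (List.map-tabulate (λ i → i) f)) (sum-tabulate f)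

  ∑ⱽ : ∀ k m → (Vec (Fin m) k → Carrier) → Carrier
  ∑ⱽ k m f = listSum (map f (allVecs k m))

  ∑ⱽ-suc : ∀ k m (f : Vec (Fin m) (suc k) → Carrier) →
           ∑ⱽ (suc k) m f ≈ ∑[ x < m ] ∑ⱽ k m (f ∘ (x ∷_))
  ∑ⱽ-suc k m f = begin
    ∑ⱽ (suc k) m f
      ≈⟨ sum-map-concatMap f (λ x → map (x ∷_) (allVecs k m)) (allFin m) ⟩
    listSum (map (λ x → listSum (map f (map (x ∷_) (allVecs k m)))) (allFin m))
      ≈⟨ sum-map-cong (allFin m) (λ x → reflexive (cong listSum (≡.sym (List.map-∘ (allVecs k m))))) ⟩
    listSum (map (λ x → ∑ⱽ k m (f ∘ (x ∷_))) (allFin m))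
      ≡⟨ sum-map-allFin m _ ⟩
    ∑[ x < m ] ∑ⱽ k m (f ∘ (x ∷_)) ∎

  ∑ⱽ-avoid : ∀ k {n} (a : Fin (suc n)) (f : Vec (Fin (suc n)) k → Carrier) → (∀ v → a ∈ v → f v ≈ 0#) →
             ∑ⱽ k (suc n) f ≈ ∑ⱽ k n (f ∘ Vec.map (punchIn a))
  ∑ⱽ-avoid zero a f _ = refl
  ∑ⱽ-avoid (suc k) {n} a f f-avoids-a = begin
    ∑ⱽ (suc k) (suc n) f
      ≈⟨ ∑ⱽ-suc k (suc n) f ⟩
    ∑[ x < suc n ] ∑ⱽ k (suc n) (f ∘ (x ∷_))
      ≈⟨ sum-remove {i = a} (λ x → ∑ⱽ k (suc n) (f ∘ (x ∷_))) ⟩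
    ∑ⱽ k (suc n) (f ∘ (a ∷_)) + ∑[ y < n ] ∑ⱽ k (suc n) (f ∘ (punchIn a y ∷_))
      ≈⟨ +-cong (sum-map-zero (allVecs k (suc n)) (λ v → f-avoids-a (a ∷ v) (here ≡.refl)))
                (sum-cong-≋ (λ y → ∑ⱽ-avoid k a (f ∘ (punchIn a y ∷_))
                                                (λ v a∈v → f-avoids-a _ (there a∈v)))) ⟩
    0# + ∑[ y < n ] ∑ⱽ k n (f ∘ Vec.map (punchIn a) ∘ (y ∷_))
      ≈⟨ +-identityˡ _ ⟩
    ∑[ y < n ] ∑ⱽ k n (f ∘ Vec.map (punchIn a) ∘ (y ∷_))
      ≈⟨ sym (∑ⱽ-suc k n (f ∘ Vec.map (punchIn a))) ⟩
    ∑ⱽ (suc k) n (f ∘ Vec.map (punchIn a)) ∎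

module Permutations where

  open Sums ℕ.+-*-commutativeSemiring
    using (_when_; when-⇔; sum-map-allFin; sum-cong-≗; sum-replicate-zero; ∑-permute; sum-syntax)
  open import Data.Product.Function.NonDependent.Propositional using (_×-⇔_)
  open import Function.Definitions using (Injective)
  open import Function.Properties.Equivalence using (⇔-setoid)
  open import Relation.Nullary.Decidable using (_×-dec_)
  open import Data.Nat using (_+_)

  injective⇒preimage : ∀ {n} {f : Fin n → Fin n} → Injective _≡_ _≡_ f → ∀ y → ∃ λ i → f i ≡ y
  injective⇒preimage {suc n} {f} f-inj y with Fin.any? (λ i → f i Fin.≟ y)
  ... | yes found = found
  ... | no ¬found = contradiction (Fin.injective⇒≤ punchOut∘f-inj) ℕ.1+n≰n
    where
    y≢f : ∀ i → y ≢ f i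
    y≢f i y≡fi = ¬found (i , ≡.sym y≡fi)
    punchOut∘f-inj : Injective _≡_ _≡_ (λ i → punchOut (y≢f i))
    punchOut∘f-inj eq = f-inj (Fin.punchOut-injective (y≢f _) (y≢f _) eq)

  injective⇒permutation : ∀ {n} {f : Fin n → Fin n} → Injective _≡_ _≡_ f → Permutation n n
  injective⇒permutation {f = f} f-inj =
    permutation f (proj₁ ∘ preimage) (proj₂ ∘ preimage) (λ i → f-inj (proj₂ (preimage (f i))))
    where
    preimage = injective⇒preimage f-inj

  IsPerm⇒injective : ∀ {n} (π : Vec (Fin n) n) → IsPerm π → Injective _≡_ _≡_ (lookup π)
  IsPerm⇒injective π π-perm = π-perm _ _

  prepend : ∀ {n} → Fin (suc n) → Vec (Fin n) n → Vec (Fin (suc n)) (suc n)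
  prepend a w = a ∷ Vec.map (punchIn a) w

  lookup-prepend : ∀ {n} (a : Fin (suc n)) (w : Vec (Fin n) n) i →
                   lookup (prepend a w) (Fin.suc i) ≡ punchIn a (lookup w i)
  lookup-prepend a w i = Vec.lookup-map i (punchIn a) w

  IsPerm-prepend⇔ : ∀ {n} (a : Fin (suc n)) (w : Vec (Fin n) n) → IsPerm (prepend a w) ⇔ IsPerm w
  IsPerm-prepend⇔ a w = mk⇔ from-prepend to-prepend
    where
    from-prepend : IsPerm (prepend a w) → IsPerm w
    from-prepend v-perm i j wi≡wj = Fin.suc-injective (v-perm (Fin.suc i) (Fin.suc j) (begin
      lookup (prepend a w) (Fin.suc i) ≡⟨ lookup-prepend a w i ⟩
      punchIn a (lookup w i)           ≡⟨ cong (punchIn a) wi≡wj ⟩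
      punchIn a (lookup w j)           ≡⟨ lookup-prepend a w j ⟨
      lookup (prepend a w) (Fin.suc j) ∎))
      where open ≡.≡-Reasoning
    to-prepend : IsPerm w → IsPerm (prepend a w)
    to-prepend w-perm Fin.zero Fin.zero _ = ≡.refl
    to-prepend w-perm Fin.zero (Fin.suc j) eq =
      contradiction (≡.sym (≡.trans eq (lookup-prepend a w j))) (Fin.punchInᵢ≢i a (lookup w j))
    to-prepend w-perm (Fin.suc i) Fin.zero eq =
      contradiction (≡.trans (≡.sym (lookup-prepend a w i)) eq) (Fin.punchInᵢ≢i a (lookup w i))
    to-prepend w-perm (Fin.suc i) (Fin.suc j) eq = cong Fin.suc (w-perm i j (Fin.punchIn-injective a _ _
      (≡.trans (≡.sym (lookup-prepend a w i)) (≡.trans eq (lookup-prepend a w j)))))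

  repeated-head⇒¬IsPerm : ∀ {n} {a : Fin (suc n)} {v : Vec (Fin (suc n)) n} → a ∈ v → ¬ IsPerm (a ∷ v)
  repeated-head⇒¬IsPerm a∈v π-perm = Fin.0≢1+n (π-perm Fin.zero (Fin.suc (index a∈v)) (lookup-index a∈v))

  punchIn-<⇔ : ∀ {n} (a : Fin (suc n)) {x y : Fin n} → punchIn a x Fin.< punchIn a y ⇔ x Fin.< y
  punchIn-<⇔ a {x} {y} = mk⇔
    (λ lt → ℕ.≰⇒> (λ y≤x → ℕ.<⇒≱ lt (Fin.punchIn-mono-≤ a y x y≤x)))
    (λ x<y → ℕ.≰⇒> (λ le → ℕ.<⇒≱ x<y (Fin.punchIn-cancel-≤ a y x le)))

  punchIn-inject₁-fromℕ : ∀ {n} (y : Fin (suc n)) → punchIn (inject₁ y) (fromℕ n) ≡ fromℕ (suc n)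
  punchIn-inject₁-fromℕ Fin.zero = ≡.refl
  punchIn-inject₁-fromℕ {suc n} (Fin.suc y) = cong Fin.suc (punchIn-inject₁-fromℕ y)

  count-below : ∀ {n} (a : Fin (suc n)) → ∑[ x < n ] (1 when (punchIn a x Fin.<? a)) ≡ toℕ a
  count-below {zero} Fin.zero = ≡.refl
  count-below {suc n} Fin.zero = sum-replicate-zero (suc n)
  count-below {suc n} (Fin.suc a) = cong suc (count-below a)

  isInversion : ∀ {n} → Vec (Fin n) n → Fin n → Fin n → ℕ
  isInversion π i j = 1 when ((i Fin.<? j) ×-dec (lookup π j Fin.<? lookup π i))

  inv≡∑isInversion : ∀ {n} (π : Vec (Fin n) n) → inv π ≡ ∑[ i < n ] ∑[ j < n ] isInversion π i j
  inv≡∑isInversion {n} π =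
    ≡.trans (sum-map-allFin n _) (sum-cong-≗ {n} (λ i → sum-map-allFin n (isInversion π i)))

  inv-prepend : ∀ {n} (a : Fin (suc n)) (w : Vec (Fin n) n) → IsPerm w → inv (prepend a w) ≡ toℕ a + inv w
  inv-prepend {n} a w w-perm = begin
    inv (prepend a w)
      ≡⟨ inv≡∑isInversion (prepend a w) ⟩
    ∑[ j < n ] isInversion (prepend a w) Fin.zero (Fin.suc j)
      + ∑[ i < n ] ∑[ j < n ] isInversion (prepend a w) (Fin.suc i) (Fin.suc j)
      ≡⟨ cong₂ _+_ first-row (sum-cong-≗ (λ i → sum-cong-≗ (inversion-prepend i))) ⟩
    toℕ a + ∑[ i < n ] ∑[ j < n ] isInversion w i j
      ≡⟨ cong (toℕ a +_) (inv≡∑isInversion w) ⟨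
    toℕ a + inv w ∎
    where
    open ≡.≡-Reasoning
    below-a : Fin n → ℕ
    below-a x = 1 when (punchIn a x Fin.<? a)
    first-row : ∑[ j < n ] isInversion (prepend a w) Fin.zero (Fin.suc j) ≡ toℕ a
    first-row = begin
      ∑[ j < n ] isInversion (prepend a w) Fin.zero (Fin.suc j)
        ≡⟨ sum-cong-≗ (λ j → cong (λ x → 1 when (x Fin.<? a)) (lookup-prepend a w j)) ⟩
      ∑[ j < n ] below-a (lookup w j)
        ≡⟨ ∑-permute below-a (injective⇒permutation (IsPerm⇒injective w w-perm)) ⟨
      ∑[ x < n ] below-a x
        ≡⟨ count-below a ⟩
      toℕ a ∎
    inversion-prepend : ∀ i j → isInversion (prepend a w) (Fin.suc i) (Fin.suc j) ≡ isInversion w i j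
    inversion-prepend i j = when-⇔ 1
      ((Fin.suc i Fin.<? Fin.suc j) ×-dec (lookup (prepend a w) (Fin.suc j) Fin.<? lookup (prepend a w) (Fin.suc i)))
      ((i Fin.<? j) ×-dec (lookup w j Fin.<? lookup w i))
      (mk⇔ ℕ.s<s⁻¹ ℕ.s<s ×-⇔ values)
      where
      values : lookup (prepend a w) (Fin.suc j) Fin.< lookup (prepend a w) (Fin.suc i) ⇔ lookup w j Fin.< lookup w i
      values rewrite lookup-prepend a w i | lookup-prepend a w j = punchIn-<⇔ a

  pickable⇔≤maxPosition : ∀ {n k} (π : Vec (Fin (suc n)) (suc n)) p → IsPerm π → lookup π p ≡ fromℕ n →
                           Pickable k π ⇔ k ≤ toℕ p
  pickable⇔≤maxPosition {n} {k} π p π-perm πp≡max = mk⇔ pickable⇒≤ ≤⇒pickable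
    where
    below-max : ∀ i → lookup π i Fin.≤ lookup π p
    below-max i = ≡.subst (lookup π i Fin.≤_) (≡.sym πp≡max) (Fin.≤fromℕ (lookup π i))
    pickable⇒≤ : Pickable k π → k ≤ toℕ p
    pickable⇒≤ (i , k≤i , i-isLRMax) =
      ℕ.≤-trans k≤i (ℕ.≮⇒≥ (λ p<i → ℕ.<⇒≱ (i-isLRMax p p<i) (below-max i)))
    ≤⇒pickable : k ≤ toℕ p → Pickable k π
    ≤⇒pickable k≤p = p , k≤p , λ j j<p →
      ℕ.≤∧≢⇒< (below-max j) (λ πj≡πp → ℕ.<⇒≢ j<p (cong toℕ (π-perm j p (Fin.toℕ-injective πj≡πp))))

  ¬pickable-prepend-fromℕ : ∀ {n k} (w : Vec (Fin n) n) → IsPerm w → ¬ Pickable (suc k) (prepend (fromℕ n) w)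
  ¬pickable-prepend-fromℕ {n} w w-perm pickable =
    contradiction (Equivalence.to (pickable⇔≤maxPosition v Fin.zero v-perm ≡.refl) pickable) λ ()
    where
    v = prepend (fromℕ n) w
    v-perm = Equivalence.from (IsPerm-prepend⇔ (fromℕ n) w) w-perm

  pickable-prepend-inject₁⇔ : ∀ {n k} (y : Fin n) (w : Vec (Fin n) n) → IsPerm w →
                              Pickable (suc k) (prepend (inject₁ y) w) ⇔ Pickable k w
  pickable-prepend-inject₁⇔ {suc n} {k} y w w-perm = begin
    Pickable (suc k) v  ≈⟨ pickable⇔≤maxPosition v (Fin.suc p) v-perm v-max ⟩
    suc k ≤ suc (toℕ p) ≈⟨ mk⇔ ℕ.s≤s⁻¹ s≤s ⟩
    k ≤ toℕ p           ≈⟨ pickable⇔≤maxPosition w p w-perm w-max ⟨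
    Pickable k w        ∎
    where
    open import Relation.Binary.Reasoning.Setoid (⇔-setoid Level.zero)
    v = prepend (inject₁ y) w
    max-position = injective⇒preimage (IsPerm⇒injective w w-perm) (fromℕ n)
    p = proj₁ max-position
    w-max = proj₂ max-position
    v-perm = Equivalence.from (IsPerm-prepend⇔ (inject₁ y) w) w-perm
    v-max : lookup v (Fin.suc p) ≡ fromℕ (suc n)
    v-max = ≡.trans (lookup-prepend (inject₁ y) w p)
                    (≡.trans (cong (punchIn (inject₁ y)) w-max) (punchIn-inject₁-fromℕ y))

module InversionGeneratingFunctions
  {c ℓ : Level} (R : CommutativeSemiring c ℓ) (θ : CommutativeSemiring.Carrier R) where

  open CommutativeSemiring R
  open Over R θ
  open Sums R
  open Permutations
  open import Function.Related.TypeIsomorphisms using (¬-cong-⇔)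
  open import Relation.Binary.Reasoning.Setoid setoid

  pow-+ : ∀ m n → pow (m ℕ.+ n) ≈ pow m * pow n
  pow-+ zero n = sym (*-identityˡ (pow n))
  pow-+ (suc m) n = trans (*-congˡ (pow-+ m n)) (sym (*-assoc θ (pow m) (pow n)))

  ∑pow≈P : ∀ n → ∑[ a < n ] pow (toℕ a) ≈ P n
  ∑pow≈P zero = refl
  ∑pow≈P (suc n) = begin
    ∑[ a < suc n ] pow (toℕ a)                          ≈⟨ sum-init-last {n} (pow ∘ toℕ) ⟩
    ∑[ y < n ] pow (toℕ (inject₁ y)) + pow (toℕ (fromℕ n))
      ≡⟨ cong₂ _+_ (sum-cong-≗ {n} (cong pow ∘ Fin.toℕ-inject₁)) (cong pow (Fin.toℕ-fromℕ n)) ⟩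
    ∑[ y < n ] pow (toℕ y) + pow n                       ≈⟨ +-congʳ (∑pow≈P n) ⟩
    P (suc n)                                            ∎

  pow-inv-prepend : ∀ {n} (a : Fin (suc n)) (w : Vec (Fin n) n) → IsPerm w →
                    pow (inv (prepend a w)) ≈ pow (toℕ a) * pow (inv w)
  pow-inv-prepend a w w-perm = trans (reflexive (cong pow (inv-prepend a w w-perm))) (pow-+ (toℕ a) (inv w))

  ∑Sym : ∀ n → (Vec (Fin n) n → Carrier) → Carrier
  ∑Sym n g = listSum (map g (Sym n))

  ∑Sym-cong : ∀ n {g h : Vec (Fin n) n → Carrier} →
              (∀ π → IsPerm π → g π ≈ h π) → ∑Sym n g ≈ ∑Sym n h
  ∑Sym-cong n g≈h = sum-map-congᴬ (All.map (λ {π} → g≈h π) (all-filter isPerm? (allVecs n n)))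

  ∑Sym-suc : ∀ n (g : Vec (Fin (suc n)) (suc n) → Carrier) →
             ∑Sym (suc n) g ≈ ∑[ a < suc n ] ∑Sym n (g ∘ prepend a)
  ∑Sym-suc n g = begin
    ∑Sym (suc n) g
      ≈⟨ sum-map-filter isPerm? g (allVecs (suc n) (suc n)) ⟩
    ∑ⱽ (suc n) (suc n) (λ v → g v when isPerm? v)
      ≈⟨ ∑ⱽ-suc n (suc n) (λ v → g v when isPerm? v) ⟩
    ∑[ a < suc n ] ∑ⱽ n (suc n) (λ v → g (a ∷ v) when isPerm? (a ∷ v))
      ≈⟨ sum-cong-≋ (λ a → ∑ⱽ-avoid n a (λ v → g (a ∷ v) when isPerm? (a ∷ v))
                             (λ v a∈v → when-no _ (isPerm? (a ∷ v)) (repeated-head⇒¬IsPerm a∈v))) ⟩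
    ∑[ a < suc n ] ∑ⱽ n n (λ w → g (prepend a w) when isPerm? (prepend a w))
      ≡⟨ sum-cong-≗ (λ a → cong listSum (List.map-cong (test-prepend a) (allVecs n n))) ⟩
    ∑[ a < suc n ] ∑ⱽ n n (λ w → g (prepend a w) when isPerm? w)
      ≈⟨ sum-cong-≋ (λ a → sum-map-filter isPerm? (g ∘ prepend a) (allVecs n n)) ⟨
    ∑[ a < suc n ] ∑Sym n (g ∘ prepend a) ∎
    where
    test-prepend : ∀ a w → g (prepend a w) when isPerm? (prepend a w) ≡ g (prepend a w) when isPerm? w
    test-prepend a w = when-⇔ (g (prepend a w)) (isPerm? (prepend a w)) (isPerm? w) (IsPerm-prepend⇔ a w)

  ∑Sym-cong-*ˡ : ∀ n {f g : Vec (Fin n) n → Carrier} {x} →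
                (∀ w → IsPerm w → f w ≈ x * g w) → ∑Sym n f ≈ x * ∑Sym n g
  ∑Sym-cong-*ˡ n {g = g} {x} f≈x*g = trans (∑Sym-cong n f≈x*g) (sym (*-distribˡ-sum-map x g (Sym n)))

  ∑Sym-pow-inv : ∀ n → ∑Sym n (pow ∘ inv) ≈ Pfact n
  ∑Sym-pow-inv zero = +-identityʳ 1#
  ∑Sym-pow-inv (suc n) = begin
    ∑Sym (suc n) (pow ∘ inv)
      ≈⟨ ∑Sym-suc n (pow ∘ inv) ⟩
    ∑[ a < suc n ] ∑Sym n (pow ∘ inv ∘ prepend a)
      ≈⟨ sum-cong-≋ {suc n} (λ a → ∑Sym-cong-*ˡ n (pow-inv-prepend a)) ⟩
    ∑[ a < suc n ] (pow (toℕ a) * ∑Sym n (pow ∘ inv))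
      ≈⟨ *-distribʳ-sum {suc n} (∑Sym n (pow ∘ inv)) (pow ∘ toℕ) ⟨
    (∑[ a < suc n ] pow (toℕ a)) * ∑Sym n (pow ∘ inv)
      ≈⟨ *-cong (∑pow≈P (suc n)) (∑Sym-pow-inv n) ⟩
    Pfact (suc n) ∎

  T₁-term : ∀ {n} → ℕ → Vec (Fin n) n → Carrier
  T₁-term k π = pow (inv π) when ¬? (pickable? k π)

  T₁≈∑Sym : ∀ n k → T₁ n k ≈ ∑Sym n (T₁-term k)
  T₁≈∑Sym n k = sum-map-filter (λ π → ¬? (pickable? k π)) (pow ∘ inv) (Sym n)

  T₁-suc-zero : ∀ n → T₁ (suc n) 0 ≈ 0#
  T₁-suc-zero n = trans (T₁≈∑Sym (suc n) 0) (sum-map-zero (Sym (suc n)) λ π →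
    when-no (pow (inv π)) (¬? (pickable? 0 π)) (λ ¬pickable → ¬pickable (Fin.zero , z≤n , λ _ ())))

  T₁-term-prepend-fromℕ : ∀ {n} k (w : Vec (Fin n) n) → IsPerm w →
                          T₁-term (suc k) (prepend (fromℕ n) w) ≈ pow n * pow (inv w)
  T₁-term-prepend-fromℕ {n} k w w-perm = begin
    T₁-term (suc k) v
      ≈⟨ when-yes (pow (inv v)) (¬? (pickable? (suc k) v)) (¬pickable-prepend-fromℕ w w-perm) ⟩
    pow (inv v)
      ≈⟨ pow-inv-prepend (fromℕ n) w w-perm ⟩
    pow (toℕ (fromℕ n)) * pow (inv w)
      ≡⟨ cong (λ m → pow m * pow (inv w)) (Fin.toℕ-fromℕ n) ⟩
    pow n * pow (inv w) ∎
    where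
    v = prepend (fromℕ n) w

  T₁-term-prepend-inject₁ : ∀ {n} k (y : Fin n) (w : Vec (Fin n) n) → IsPerm w →
                            T₁-term (suc k) (prepend (inject₁ y) w) ≈ pow (toℕ y) * T₁-term k w
  T₁-term-prepend-inject₁ k y w w-perm = begin
    T₁-term (suc k) v
      ≡⟨ when-⇔ (pow (inv v)) (¬? (pickable? (suc k) v)) (¬? (pickable? k w))
                (¬-cong-⇔ (pickable-prepend-inject₁⇔ y w w-perm)) ⟩
    pow (inv v) when ¬? (pickable? k w)
      ≈⟨ when-congˡ (¬? (pickable? k w)) (pow-inv-prepend (inject₁ y) w w-perm) ⟩
    pow (toℕ (inject₁ y)) * pow (inv w) when ¬? (pickable? k w)
      ≈⟨ *-distribˡ-when (pow (toℕ (inject₁ y))) (pow (inv w)) (¬? (pickable? k w)) ⟨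
    pow (toℕ (inject₁ y)) * T₁-term k w
      ≡⟨ cong (λ m → pow m * T₁-term k w) (Fin.toℕ-inject₁ y) ⟩
    pow (toℕ y) * T₁-term k w ∎
    where
    v = prepend (inject₁ y) w

  T₁-recurrence : ∀ n k → T₁ (suc n) (suc k) ≈ P n * T₁ n k + pow n * Pfact n
  T₁-recurrence n k = begin
    T₁ (suc n) (suc k)
      ≈⟨ T₁≈∑Sym (suc n) (suc k) ⟩
    ∑Sym (suc n) (T₁-term (suc k))
      ≈⟨ ∑Sym-suc n (T₁-term (suc k)) ⟩
    ∑[ a < suc n ] ∑Sym n (T₁-term (suc k) ∘ prepend a)
      ≈⟨ sum-init-last {n} (λ a → ∑Sym n (T₁-term (suc k) ∘ prepend a)) ⟩
    ∑[ y < n ] ∑Sym n (T₁-term (suc k) ∘ prepend (inject₁ y))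
      + ∑Sym n (T₁-term (suc k) ∘ prepend (fromℕ n))
      ≈⟨ +-cong (sum-cong-≋ {n} (λ y → ∑Sym-cong-*ˡ n (T₁-term-prepend-inject₁ k y)))
                (∑Sym-cong-*ˡ n (T₁-term-prepend-fromℕ k)) ⟩
    ∑[ y < n ] (pow (toℕ y) * ∑Sym n (T₁-term k)) + pow n * ∑Sym n (pow ∘ inv)
      ≈⟨ +-cong (sym (*-distribʳ-sum {n} (∑Sym n (T₁-term k)) (pow ∘ toℕ))) (*-congˡ (∑Sym-pow-inv n)) ⟩
    (∑[ y < n ] pow (toℕ y)) * ∑Sym n (T₁-term k) + pow n * Pfact n
      ≈⟨ +-congʳ (*-cong (∑pow≈P n) (sym (T₁≈∑Sym n k))) ⟩
    P n * T₁ n k + pow n * Pfact n ∎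

  topPowers-suc : ∀ n k → topPowers (suc n) (suc k) ≈ topPowers n k + pow n
  topPowers-suc n zero = refl
  topPowers-suc n (suc k) = trans (+-congʳ (topPowers-suc n k)) (+.xy∙z≈xz∙y _ _ _)
    where module + = Algebra.Properties.CommutativeSemigroup +-commutativeSemigroup

  T₁-closedForm : ∀ n k → k ≤ n → T₁ (suc n) (suc k) ≈ topPowers (suc n) (suc k) * Pfact n
  T₁-closedForm n zero _ = begin
    T₁ (suc n) 1                    ≈⟨ T₁-recurrence n 0 ⟩
    P n * T₁ n 0 + pow n * Pfact n  ≈⟨ +-congʳ (P*T₁[n,0]≈0 n) ⟩
    0# + pow n * Pfact n            ≈⟨ +-congʳ (zeroˡ (Pfact n)) ⟨
    0# * Pfact n + pow n * Pfact n  ≈⟨ distribʳ (Pfact n) 0# (pow n) ⟨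
    (0# + pow n) * Pfact n          ∎
    where
    P*T₁[n,0]≈0 : ∀ n → P n * T₁ n 0 ≈ 0#
    P*T₁[n,0]≈0 zero = zeroˡ (T₁ 0 0)
    P*T₁[n,0]≈0 (suc n) = trans (*-congˡ (T₁-suc-zero n)) (zeroʳ (P (suc n)))
  T₁-closedForm (suc n) (suc k) (s≤s k≤n) = begin
    T₁ (2+ n) (2+ k)
      ≈⟨ T₁-recurrence (suc n) (suc k) ⟩
    P (suc n) * T₁ (suc n) (suc k) + pow (suc n) * Pfact (suc n)
      ≈⟨ +-congʳ (*-congˡ (T₁-closedForm n k k≤n)) ⟩
    P (suc n) * (topPowers (suc n) (suc k) * Pfact n) + pow (suc n) * Pfact (suc n)
      ≈⟨ +-congʳ (*.x∙yz≈y∙xz (P (suc n)) (topPowers (suc n) (suc k)) (Pfact n)) ⟩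
    topPowers (suc n) (suc k) * Pfact (suc n) + pow (suc n) * Pfact (suc n)
      ≈⟨ distribʳ (Pfact (suc n)) (topPowers (suc n) (suc k)) (pow (suc n)) ⟨
    (topPowers (suc n) (suc k) + pow (suc n)) * Pfact (suc n)
      ≈⟨ *-congʳ (topPowers-suc (suc n) (suc k)) ⟨
    topPowers (2+ n) (2+ k) * Pfact (suc n) ∎
    where module * = Algebra.Properties.CommutativeSemigroup *-commutativeSemigroup

lemma9 : ∀ {c ℓ : Level} (R : CommutativeSemiring c ℓ) (θ : CommutativeSemiring.Carrier R) →
    let open CommutativeSemiring R
        open Over R θ
    in
      (∀ (N : ℕ) → 1 ≤ N → T₁ N 0 ≈ 0#)
      × (∀ (N k : ℕ) → 1 ≤ k → k ≤ N → T₁ N k ≈ topPowers N k * Pfact (N ∸ 1))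
lemma9 R θ = (λ { (suc n) _ → T₁-suc-zero n })
           , (λ { (suc n) (suc k) _ (s≤s k≤n) → T₁-closedForm n k k≤n })
  where open InversionGeneratingFunctions R θ
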